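{- Let $S=\{R_0,\ldots,R_d\}$ be an association scheme on a nonempty finite set $X$, let $\mathbb{F}$ be a field, let $x\in X$, let $\mathcal{T}$ be the Terwilliger $\mathbb{F}$-algebra of $S$ with respect to $x$ and $\mathcal{J}$ its Jacobson radical. Assume that $E_a^*ME_b^*=O$ for all $M\in\mathcal{J}$ and all distinct $a,b\in\{0,\ldots,d\}$. Then $\mathcal{T}$ is semisimple if and only if the $\mathbb{F}$-algebra $E_c^*\mathcal{T}E_c^*=\{E_c^*ME_c^*: M\in\mathcal{T}\}$ (with identity $E_c^*$) is semisimple for every $c\in\{0,\ldots,d\}$.
   Context: An association scheme on $X$ is a partition $S=\{R_0,\ldots,R_d\}$ of $X\times X$ into nonempty relations with $R_0$ the diagonal, closed under transposes, such that $p_{ij}^k=|\{\ell:(m,\ell)\in R_i,(\ell,n)\in R_j\}|$ is independent of $(m,n)\in R_k$. $xR_a=\{z:(x,z)\in R_a\}$. $A_b\in M_X(\mathbb{F})$ is the $(0,1)$ adjacency matrix of $R_b$, $E_z^*$ the diagonal $(0,1)$-matrix with $(i,i)$-entry $1$ iff $i\in xR_z$, and $\mathcal{T}$ the $\mathbb{F}$-subalgebra of $M_X(\mathbb{F})$ generated by all $A_b,E_z^*$. $O$ is the zero matrix. -}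

module Defs where

open import Level using (Level; _⊔_) renaming (suc to lsuc)
open import Algebra.Bundles using (CommutativeRing)
open import Data.Nat using (ℕ; zero; suc)
open import Data.Fin using (Fin; zero; suc)
open import Data.Fin.Properties using (_≟_)
open import Data.Product using (Σ; ∃; ∃₂; _×_; _,_)
open import Relation.Nullary using (¬_; Dec; yes; no)
open import Relation.Binary.PropositionalEquality using (_≡_)

record Field c ℓ : Set (lsuc (c ⊔ ℓ)) where
  field
    commutativeRing : CommutativeRing c ℓ
  open CommutativeRing commutativeRing public
  field
    0≉1     : ¬ (0# ≈ 1#)
    inverse : ∀ x → ¬ (x ≈ 0#) → Σ Carrier λ y → (x * y) ≈ 1#

count : ∀ {n} {p} {P : Fin n → Set p} → (∀ i → Dec (P i)) → ℕ
count {zero}  P? = 0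
count {suc n} P? with P? zero
... | yes _ = suc (count (λ i → P? (suc i)))
... | no  _ = count (λ i → P? (suc i))

both? : ∀ {n d} (r : Fin n → Fin n → Fin (suc d)) (i j : Fin n) (a b : Fin (suc d))
        (l : Fin n) → Dec ((r i l ≡ a) × (r l j ≡ b))
both? r i j a b l with r i l ≟ a | r l j ≟ b
... | yes p | yes q = yes (p , q)
... | no ¬p | _     = no λ { (p , _) → ¬p p }
... | yes _ | no ¬q = no λ { (_ , q) → ¬q q }

intersectionCount : ∀ {n d} (r : Fin n → Fin n → Fin (suc d))
                    (a b : Fin (suc d)) (i j : Fin n) → ℕ
intersectionCount r a b i j = count (both? r i j a b)

-- Association schemes on X = Fin n with classes R_0 , … , R_d.
-- The partition is given by the function  rel  : (i , j) ∈ R_(rel i j).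

record AssociationScheme (n d : ℕ) : Set where
  field
    rel       : Fin n → Fin n → Fin (suc d)
    diagonal₁ : ∀ i j → rel i j ≡ zero → i ≡ j
    diagonal₂ : ∀ i → rel i i ≡ zero
    nonempty  : ∀ a → ∃₂ λ i j → rel i j ≡ a
    transpose : ∀ a → ∃ λ a' → ∀ i j → (rel i j ≡ a → rel j i ≡ a') × (rel j i ≡ a' → rel i j ≡ a)
    -- intersection numbers are well defined
    regular   : ∀ a b i j k l → rel i j ≡ rel k l →
                intersectionCount rel a b i j ≡ intersectionCount rel a b k l

module Matrices {c ℓ} (F : Field c ℓ) (n : ℕ) where
  open Field F using (Carrier; _≈_; _+_; _*_; _-_; 0#; 1#)

  Mat : Set c
  Mat = Fin n → Fin n → Carrier

  infix 4 _≋_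
  _≋_ : Mat → Mat → Set ℓ
  M ≋ N = ∀ i j → M i j ≈ N i j

  sumFin : ∀ {m} → (Fin m → Carrier) → Carrier
  sumFin {zero}  f = 0#
  sumFin {suc m} f = f zero + sumFin (λ i → f (suc i))

  O : Mat
  O i j = 0#

  I : Mat
  I i j with i ≟ j
  ... | yes _ = 1#
  ... | no  _ = 0#

  _⊕_ : Mat → Mat → Mat
  (M ⊕ N) i j = M i j + N i j

  _⊖_ : Mat → Mat → Mat
  (M ⊖ N) i j = M i j - N i j

  _⊗_ : Mat → Mat → Mat
  (M ⊗ N) i j = sumFin λ k → M i k * N k j

  _·_ : Carrier → Mat → Mat
  (s · M) i j = s * M i j

  infixl 6 _⊕_ _⊖_
  infixl 7 _⊗_ _·_

  -- A subalgebra (given as a predicate P on M_X(F)) with identity element e,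
  -- regarded as an F-algebra in its own right.
  -- Jacobson radical (quasi-regular element characterisation):
  --   J(A) = { m ∈ A : for all a ∈ A, e - a m has a left inverse in A }.
  JacobsonRadical : ∀ {p} → (Mat → Set p) → Mat → Mat → Set (c ⊔ ℓ ⊔ p)
  JacobsonRadical P e M =
    P M × (∀ N → P N → Σ Mat λ Q → P Q × (Q ⊗ (e ⊖ N ⊗ M) ≋ e))

  -- Semisimple (finite-dimensional algebra): the Jacobson radical is zero.
  Semisimple : ∀ {p} → (Mat → Set p) → Mat → Set (c ⊔ ℓ ⊔ p)
  Semisimple P e = ∀ M → JacobsonRadical P e M → M ≋ O

module Terwilliger {c ℓ} (F : Field c ℓ) {n d : ℕ}
                   (S : AssociationScheme n d) (x : Fin n) where
  open Field F using (Carrier; 0#; 1#)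
  open AssociationScheme S
  open Matrices F n public

  A : Fin (suc d) → Mat
  A b i j with rel i j ≟ b
  ... | yes _ = 1#
  ... | no  _ = 0#

  E* : Fin (suc d) → Mat
  E* z i j with i ≟ j | rel x i ≟ z
  ... | yes _ | yes _ = 1#
  ... | _     | _     = 0#

  data InT : Mat → Set (c ⊔ ℓ) where
    genA  : ∀ b → InT (A b)
    genE  : ∀ z → InT (E* z)
    t-one : InT I
    t-add : ∀ {M N} → InT M → InT N → InT (M ⊕ N)
    t-mul : ∀ {M N} → InT M → InT N → InT (M ⊗ N)
    t-scl : ∀ s {M} → InT M → InT (s · M)
    t-eq  : ∀ {M N} → M ≋ N → InT M → InT N

  InCorner : Fin (suc d) → Mat → Set (c ⊔ ℓ)
  InCorner z N = Σ Mat λ M → InT M × (N ≋ E* z ⊗ M ⊗ E* z)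

{-# OPTIONS --safe #-}
module Submission where

-- For an idempotent e of a ring R, the corner eRe has radical J(eRe) = e J(R) e.
-- If M ∈ J(R) then eMe stays quasi-regular in eRe. Conversely, if N ∈ J(eRe)
-- and y ∈ R, a left inverse of e - (eye)N in eRe, extended by 1 - e, is a left
-- inverse of 1 - e(yN) in R, and Jacobson's lemma (1 - ab is invertible iff
-- 1 - ba is) turns it into one of 1 - yN. In 𝒯 with e = E*_a, the diagonal
-- blocks E*_a M E*_a of a radical element M are thus radical in the corners,
-- hence zero when the corners are semisimple; the off-diagonal blocks vanish
-- by hypothesis, and M is the sum of its blocks.

open import Defs
open import Level using (_⊔_)
open import Algebra.Bundles using (Ring)
open import Algebra.Structures using (IsRing)
import Algebra.Construct.Pointwise as Pointwise
open import Data.Nat using (ℕ; zero; suc)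
open import Data.Fin using (Fin; punchIn)
open import Data.Fin.Properties using (_≟_; punchInᵢ≢i)
open import Data.Product using (Σ; _×_; _,_)
open import Data.Empty using (⊥-elim)
open import Function.Base using (_∘_)
open import Function.Bundles using (_⇔_; mk⇔)
open import Relation.Nullary using (¬_; Dec; yes; no)
open import Relation.Binary.PropositionalEquality as ≡ using (_≡_)

module MatrixRing {c ℓ} (F : Field c ℓ) (n : ℕ) where
  open Field F hiding (zero)
  open Matrices F n
  open import Algebra.Properties.Semiring.Sum semiring
    using (sum; sum-syntax; sum-cong-≋; sum-remove; sum-replicate-zero;
           ∑-distrib-+; ∑-comm; *-distribˡ-sum; *-distribʳ-sum)
  open import Relation.Binary.Reasoning.Setoid setoid

  sumFin≡sum : ∀ {m} (f : Fin m → Carrier) → sumFin f ≡ sum f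
  sumFin≡sum {zero}  f = ≡.refl
  sumFin≡sum {suc m} f = ≡.cong (f Fin.zero +_) (sumFin≡sum (f ∘ Fin.suc))

  sum-single : ∀ {m} (f : Fin m → Carrier) k → (∀ l → ¬ l ≡ k → f l ≈ 0#) → sum f ≈ f k
  sum-single {suc m} f k vanish = begin
    sum f                            ≈⟨ sum-remove {i = k} f ⟩
    f k + ∑[ l < m ] f (punchIn k l) ≈⟨ +-congˡ (sum-cong-≋ (λ l → vanish _ (punchInᵢ≢i k l))) ⟩
    f k + ∑[ l < m ] 0#              ≈⟨ +-congˡ (sum-replicate-zero m) ⟩
    f k + 0#                         ≈⟨ +-identityʳ (f k) ⟩
    f k                              ∎

  ⊗-entry : ∀ M N i j → (M ⊗ N) i j ≈ ∑[ k < n ] (M i k * N k j)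
  ⊗-entry M N i j = reflexive (sumFin≡sum (λ k → M i k * N k j))

  IsDiagonal : Mat → Set ℓ
  IsDiagonal D = ∀ {i j} → ¬ i ≡ j → D i j ≈ 0#

  diagonal-⊗ : ∀ {D} → IsDiagonal D → ∀ M i j → (D ⊗ M) i j ≈ D i i * M i j
  diagonal-⊗ {D} D-diag M i j = trans (⊗-entry D M i j)
    (sum-single _ i (λ k k≢i → trans (*-congʳ (D-diag (k≢i ∘ ≡.sym))) (zeroˡ _)))

  ⊗-diagonal : ∀ {D} → IsDiagonal D → ∀ M i j → (M ⊗ D) i j ≈ M i j * D j j
  ⊗-diagonal {D} D-diag M i j = trans (⊗-entry M D i j)
    (sum-single _ j (λ k k≢j → trans (*-congˡ (D-diag k≢j)) (zeroʳ _)))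

  I-isDiagonal : IsDiagonal I
  I-isDiagonal {i} {j} i≢j with i ≟ j
  ... | yes i≡j = ⊥-elim (i≢j i≡j)
  ... | no _    = refl

  I-diagonal : ∀ i → I i i ≈ 1#
  I-diagonal i with i ≟ i
  ... | yes _   = refl
  ... | no  i≢i = ⊥-elim (i≢i ≡.refl)

  ⊗-cong : ∀ {M M′ N N′} → M ≋ M′ → N ≋ N′ → M ⊗ N ≋ M′ ⊗ N′
  ⊗-cong {M} {M′} {N} {N′} M≋M′ N≋N′ i j = begin
    (M ⊗ N) i j                  ≈⟨ ⊗-entry M N i j ⟩
    ∑[ k < n ] (M i k * N k j)   ≈⟨ sum-cong-≋ (λ k → *-cong (M≋M′ i k) (N≋N′ k j)) ⟩
    ∑[ k < n ] (M′ i k * N′ k j) ≈⟨ ⊗-entry M′ N′ i j ⟨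
    (M′ ⊗ N′) i j                ∎

  ⊗-assoc : ∀ A B C → (A ⊗ B) ⊗ C ≋ A ⊗ (B ⊗ C)
  ⊗-assoc A B C i j = begin
    ((A ⊗ B) ⊗ C) i j
      ≈⟨ ⊗-entry (A ⊗ B) C i j ⟩
    ∑[ k < n ] ((A ⊗ B) i k * C k j)
      ≈⟨ sum-cong-≋ (λ k → *-congʳ (⊗-entry A B i k)) ⟩
    ∑[ k < n ] (∑[ l < n ] (A i l * B l k) * C k j)
      ≈⟨ sum-cong-≋ (λ k → *-distribʳ-sum (C k j) (λ l → A i l * B l k)) ⟩
    ∑[ k < n ] ∑[ l < n ] (A i l * B l k * C k j)
      ≈⟨ ∑-comm (λ k l → A i l * B l k * C k j) ⟩
    ∑[ l < n ] ∑[ k < n ] (A i l * B l k * C k j)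
      ≈⟨ sum-cong-≋ (λ l → sum-cong-≋ (λ k → *-assoc (A i l) (B l k) (C k j))) ⟩
    ∑[ l < n ] ∑[ k < n ] (A i l * (B l k * C k j))
      ≈⟨ sum-cong-≋ (λ l → *-distribˡ-sum (A i l) (λ k → B l k * C k j)) ⟨
    ∑[ l < n ] (A i l * ∑[ k < n ] (B l k * C k j))
      ≈⟨ sum-cong-≋ (λ l → *-congˡ (⊗-entry B C l j)) ⟨
    ∑[ l < n ] (A i l * (B ⊗ C) l j)
      ≈⟨ ⊗-entry A (B ⊗ C) i j ⟨
    (A ⊗ (B ⊗ C)) i j
      ∎

  ⊗-identityˡ : ∀ M → I ⊗ M ≋ M
  ⊗-identityˡ M i j =
    trans (diagonal-⊗ I-isDiagonal M i j) (trans (*-congʳ (I-diagonal i)) (*-identityˡ _))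

  ⊗-identityʳ : ∀ M → M ⊗ I ≋ M
  ⊗-identityʳ M i j =
    trans (⊗-diagonal I-isDiagonal M i j) (trans (*-congˡ (I-diagonal j)) (*-identityʳ _))

  ⊗-distribˡ-⊕ : ∀ A B C → A ⊗ (B ⊕ C) ≋ A ⊗ B ⊕ A ⊗ C
  ⊗-distribˡ-⊕ A B C i j = begin
    (A ⊗ (B ⊕ C)) i j                                   ≈⟨ ⊗-entry A (B ⊕ C) i j ⟩
    ∑[ k < n ] (A i k * (B k j + C k j))                 ≈⟨ sum-cong-≋ (λ k → distribˡ (A i k) _ _) ⟩
    ∑[ k < n ] (A i k * B k j + A i k * C k j)           ≈⟨ ∑-distrib-+ (λ k → A i k * B k j) (λ k → A i k * C k j) ⟩
    ∑[ k < n ] (A i k * B k j) + ∑[ k < n ] (A i k * C k j) ≈⟨ +-cong (⊗-entry A B i j) (⊗-entry A C i j) ⟨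
    (A ⊗ B ⊕ A ⊗ C) i j                                 ∎

  ⊗-distribʳ-⊕ : ∀ A B C → (B ⊕ C) ⊗ A ≋ B ⊗ A ⊕ C ⊗ A
  ⊗-distribʳ-⊕ A B C i j = begin
    ((B ⊕ C) ⊗ A) i j                                   ≈⟨ ⊗-entry (B ⊕ C) A i j ⟩
    ∑[ k < n ] ((B i k + C i k) * A k j)                 ≈⟨ sum-cong-≋ (λ k → distribʳ (A k j) _ _) ⟩
    ∑[ k < n ] (B i k * A k j + C i k * A k j)           ≈⟨ ∑-distrib-+ (λ k → B i k * A k j) (λ k → C i k * A k j) ⟩
    ∑[ k < n ] (B i k * A k j) + ∑[ k < n ] (C i k * A k j) ≈⟨ +-cong (⊗-entry B A i j) (⊗-entry C A i j) ⟨
    (B ⊗ A ⊕ C ⊗ A) i j                                 ∎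

  ⊝_ : Mat → Mat
  (⊝ M) i j = - M i j

  ⊗-isRing : IsRing _≋_ _⊕_ _⊗_ ⊝_ O I
  ⊗-isRing = record
    { +-isAbelianGroup =
        Pointwise.isAbelianGroup (Fin n) (Pointwise.isAbelianGroup (Fin n) +-isAbelianGroup)
    ; *-cong     = ⊗-cong
    ; *-assoc    = ⊗-assoc
    ; *-identity = ⊗-identityˡ , ⊗-identityʳ
    ; distrib    = ⊗-distribˡ-⊕ , ⊗-distribʳ-⊕
    }

  ⊗-ring : Ring c ℓ
  ⊗-ring = record { isRing = ⊗-isRing }

record IsSubring {c ℓ p} (R : Ring c ℓ) (P : Ring.Carrier R → Set p) : Set (c ⊔ ℓ ⊔ p) where
  open Ring R
  field
    ∈-resp-≈ : ∀ {x y} → x ≈ y → P x → P y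
    1∈       : P 1#
    +-closed : ∀ {x y} → P x → P y → P (x + y)
    *-closed : ∀ {x y} → P x → P y → P (x * y)
    -‿closed : ∀ {x} → P x → P (- x)

  -closed : ∀ {x y} → P x → P y → P (x - y)
  -closed x∈P y∈P = +-closed x∈P (-‿closed y∈P)

module RingIdentities {c ℓ} (R : Ring c ℓ) where
  open Ring R
  open import Algebra.Properties.Ring R using (x[y-z]≈xy-xz; [y-z]x≈yx-zx; //-rightDividesˡ; -0#≈0#)
  open import Relation.Binary.Reasoning.Setoid setoid

  [1+aub][1-ab]≈1 : ∀ a b u → u * (1# - b * a) ≈ 1# → (1# + a * u * b) * (1# - a * b) ≈ 1#
  [1+aub][1-ab]≈1 a b u u-inv = begin
    (1# + a * u * b) * (1# - a * b)               ≈⟨ distribʳ _ _ _ ⟩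
    1# * (1# - a * b) + a * u * b * (1# - a * b)  ≈⟨ +-cong (*-identityˡ _) aub[1-ab]≈ab ⟩
    1# - a * b + a * b                            ≈⟨ //-rightDividesˡ (a * b) 1# ⟩
    1#                                            ∎
    where
    b[1-ab]≈[1-ba]b : b * (1# - a * b) ≈ (1# - b * a) * b
    b[1-ab]≈[1-ba]b = begin
      b * (1# - a * b)      ≈⟨ x[y-z]≈xy-xz b 1# (a * b) ⟩
      b * 1# - b * (a * b)  ≈⟨ +-cong (trans (*-identityʳ b) (sym (*-identityˡ b)))
                                      (-‿cong (sym (*-assoc b a b))) ⟩
      1# * b - b * a * b    ≈⟨ [y-z]x≈yx-zx b 1# (b * a) ⟨
      (1# - b * a) * b      ∎
    aub[1-ab]≈ab : a * u * b * (1# - a * b) ≈ a * b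
    aub[1-ab]≈ab = begin
      a * u * b * (1# - a * b)    ≈⟨ *-assoc (a * u) b _ ⟩
      a * u * (b * (1# - a * b))  ≈⟨ *-congˡ b[1-ab]≈[1-ba]b ⟩
      a * u * ((1# - b * a) * b)  ≈⟨ *-assoc (a * u) _ b ⟨
      a * u * (1# - b * a) * b    ≈⟨ *-congʳ (*-assoc a u _) ⟩
      a * (u * (1# - b * a)) * b  ≈⟨ *-congʳ (*-congˡ u-inv) ⟩
      a * 1# * b                  ≈⟨ *-congʳ (*-identityʳ a) ⟩
      a * b                       ∎

  -- The complementary idempotent 1 - e fills in the missing unit.
  [q+1-e][1-w]≈1 : ∀ {e q w} → q * e ≈ q → e * w ≈ w → q * (e - w) ≈ e →
                   (q + (1# - e)) * (1# - w) ≈ 1#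
  [q+1-e][1-w]≈1 {e} {q} {w} qe≈q ew≈w q-inv = begin
    (q + (1# - e)) * (1# - w)              ≈⟨ distribʳ _ _ _ ⟩
    q * (1# - w) + (1# - e) * (1# - w)     ≈⟨ +-cong q[1-w]≈e [1-e][1-w]≈1-e ⟩
    e + (1# - e)                           ≈⟨ +-comm e _ ⟩
    1# - e + e                             ≈⟨ //-rightDividesˡ e 1# ⟩
    1#                                     ∎
    where
    q[1-w]≈e : q * (1# - w) ≈ e
    q[1-w]≈e = begin
      q * (1# - w)        ≈⟨ x[y-z]≈xy-xz q 1# w ⟩
      q * 1# - q * w      ≈⟨ +-congʳ (trans (*-identityʳ q) (sym qe≈q)) ⟩
      q * e - q * w       ≈⟨ x[y-z]≈xy-xz q e w ⟨
      q * (e - w)         ≈⟨ q-inv ⟩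
      e                   ∎
    [1-e]w≈0 : (1# - e) * w ≈ 0#
    [1-e]w≈0 = begin
      (1# - e) * w        ≈⟨ [y-z]x≈yx-zx w 1# e ⟩
      1# * w - e * w      ≈⟨ +-cong (*-identityˡ w) (-‿cong ew≈w) ⟩
      w - w               ≈⟨ -‿inverseʳ w ⟩
      0#                  ∎
    [1-e][1-w]≈1-e : (1# - e) * (1# - w) ≈ 1# - e
    [1-e][1-w]≈1-e = begin
      (1# - e) * (1# - w)             ≈⟨ x[y-z]≈xy-xz _ 1# w ⟩
      (1# - e) * 1# - (1# - e) * w    ≈⟨ +-cong (*-identityʳ _) (-‿cong [1-e]w≈0) ⟩
      (1# - e) - 0#                   ≈⟨ +-congˡ -0#≈0# ⟩
      (1# - e) + 0#                   ≈⟨ +-identityʳ _ ⟩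
      1# - e                          ∎

  [eue][e-xe]≈e : ∀ {e u x} → e * e ≈ e → e * x ≈ x → u * (1# - x) ≈ 1# →
                  e * u * e * (e - x * e) ≈ e
  [eue][e-xe]≈e {e} {u} {x} ee≈e ex≈x u-inv = begin
    e * u * e * (e - x * e)    ≈⟨ *-assoc (e * u) e _ ⟩
    e * u * (e * (e - x * e))  ≈⟨ *-congˡ e[e-xe]≈e-xe ⟩
    e * u * (e - x * e)        ≈⟨ *-congˡ e-xe≈[1-x]e ⟩
    e * u * ((1# - x) * e)     ≈⟨ *-assoc (e * u) _ e ⟨
    e * u * (1# - x) * e       ≈⟨ *-congʳ (*-assoc e u _) ⟩
    e * (u * (1# - x)) * e     ≈⟨ *-congʳ (*-congˡ u-inv) ⟩
    e * 1# * e                 ≈⟨ *-congʳ (*-identityʳ e) ⟩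
    e * e                      ≈⟨ ee≈e ⟩
    e                          ∎
    where
    e[e-xe]≈e-xe : e * (e - x * e) ≈ e - x * e
    e[e-xe]≈e-xe = begin
      e * (e - x * e)        ≈⟨ x[y-z]≈xy-xz e e (x * e) ⟩
      e * e - e * (x * e)    ≈⟨ +-cong ee≈e (-‿cong (trans (sym (*-assoc e x e)) (*-congʳ ex≈x))) ⟩
      e - x * e              ∎
    e-xe≈[1-x]e : e - x * e ≈ (1# - x) * e
    e-xe≈[1-x]e = begin
      e - x * e              ≈⟨ +-congʳ (*-identityˡ e) ⟨
      1# * e - x * e         ≈⟨ [y-z]x≈yx-zx e 1# x ⟨
      (1# - x) * e           ∎

module CornerRadical {c ℓ p} (R : Ring c ℓ) {P : Ring.Carrier R → Set p}
                     (P-isSubring : IsSubring R P) where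
  open Ring R
  open IsSubring P-isSubring
  open RingIdentities R
  open import Relation.Binary.Reasoning.Setoid setoid

  HasLeftInverse : ∀ {q} → (Carrier → Set q) → Carrier → Carrier → Set (c ⊔ ℓ ⊔ q)
  HasLeftInverse Q e x = Σ Carrier λ u → Q u × (u * x ≈ e)

  -- Unfolds to Defs.JacobsonRadical when R is the matrix ring.
  Radical : ∀ {q} → (Carrier → Set q) → Carrier → Carrier → Set (c ⊔ ℓ ⊔ q)
  Radical Q e m = Q m × (∀ y → Q y → HasLeftInverse Q e (e - y * m))

  Corner : Carrier → Carrier → Set (c ⊔ ℓ ⊔ p)
  Corner e z = Σ Carrier λ m → P m × (z ≈ e * m * e)

  hasLeftInverse-resp : ∀ {q} {Q : Carrier → Set q} {e x y} → x ≈ y →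
                        HasLeftInverse Q e x → HasLeftInverse Q e y
  hasLeftInverse-resp x≈y (u , u∈Q , ux≈e) = u , u∈Q , trans (*-congˡ (sym x≈y)) ux≈e

  hasLeftInverse-swap : ∀ {a b} → P a → P b →
                        HasLeftInverse P 1# (1# - b * a) → HasLeftInverse P 1# (1# - a * b)
  hasLeftInverse-swap {a} {b} a∈P b∈P (u , u∈P , u-inv) =
    1# + a * u * b , +-closed 1∈ (*-closed (*-closed a∈P u∈P) b∈P) , [1+aub][1-ab]≈1 _ _ u u-inv

  module _ {e} (e∈P : P e) (ee≈e : e * e ≈ e) where

    corner⇒∈ : ∀ {z} → Corner e z → P z
    corner⇒∈ (m , m∈P , z≈eme) = ∈-resp-≈ (sym z≈eme) (*-closed (*-closed e∈P m∈P) e∈P)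

    corner-absorbˡ : ∀ {z} → Corner e z → e * z ≈ z
    corner-absorbˡ {z} (m , _ , z≈eme) = begin
      e * z            ≈⟨ *-congˡ z≈eme ⟩
      e * (e * m * e)  ≈⟨ *-assoc e (e * m) e ⟨
      e * (e * m) * e  ≈⟨ *-congʳ (*-assoc e e m) ⟨
      e * e * m * e    ≈⟨ *-congʳ (*-congʳ ee≈e) ⟩
      e * m * e        ≈⟨ z≈eme ⟨
      z                ∎

    corner-absorbʳ : ∀ {z} → Corner e z → z * e ≈ z
    corner-absorbʳ {z} (m , _ , z≈eme) = begin
      z * e            ≈⟨ *-congʳ z≈eme ⟩
      e * m * e * e    ≈⟨ *-assoc (e * m) e e ⟩
      e * m * (e * e)  ≈⟨ *-congˡ ee≈e ⟩
      e * m * e        ≈⟨ z≈eme ⟨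
      z                ∎

    hasLeftInverse-extend : ∀ {w} → e * w ≈ w →
                            HasLeftInverse (Corner e) e (e - w) → HasLeftInverse P 1# (1# - w)
    hasLeftInverse-extend ew≈w (q , q∈eRe , q-inv) =
      q + (1# - e) , +-closed (corner⇒∈ q∈eRe) (-closed 1∈ e∈P) ,
      [q+1-e][1-w]≈1 (corner-absorbʳ q∈eRe) ew≈w q-inv

    radical-corner⇒radical : ∀ {N} → Radical (Corner e) e N → Radical P 1# N
    radical-corner⇒radical {N} (N∈eRe , N-rad) = corner⇒∈ N∈eRe , inverse
      where
      eyeN≈eyN : ∀ y → e * y * e * N ≈ e * (y * N)
      eyeN≈eyN y = begin
        e * y * e * N    ≈⟨ *-assoc (e * y) e N ⟩
        e * y * (e * N)  ≈⟨ *-congˡ (corner-absorbˡ N∈eRe) ⟩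
        e * y * N        ≈⟨ *-assoc e y N ⟩
        e * (y * N)      ∎
      inverse : ∀ y → P y → HasLeftInverse P 1# (1# - y * N)
      inverse y y∈P =
        hasLeftInverse-resp (+-congˡ (-‿cong (trans (*-assoc y N e) (*-congˡ (corner-absorbʳ N∈eRe)))))
          (hasLeftInverse-swap (*-closed y∈P (corner⇒∈ N∈eRe)) e∈P
            (hasLeftInverse-extend (trans (sym (*-assoc e e _)) (*-congʳ ee≈e))
              (hasLeftInverse-resp (+-congˡ (-‿cong (eyeN≈eyN y)))
                (N-rad (e * y * e) (y , y∈P , refl)))))

    radical⇒corner-radical : ∀ {M} → Radical P 1# M → Radical (Corner e) e (e * M * e)
    radical⇒corner-radical {M} (M∈P , M-rad) = (M , M∈P , refl) , inverse
      where
      inverse : ∀ N → Corner e N → HasLeftInverse (Corner e) e (e - N * (e * M * e))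
      inverse N N∈eRe with M-rad N (corner⇒∈ N∈eRe)
      ... | u , u∈P , u-inv = e * u * e , (u , u∈P , refl) ,
        trans (*-congˡ (+-congˡ (-‿cong NeMe≈NMe)))
              ([eue][e-xe]≈e ee≈e (trans (sym (*-assoc e N M)) (*-congʳ (corner-absorbˡ N∈eRe))) u-inv)
        where
        NeMe≈NMe : N * (e * M * e) ≈ N * M * e
        NeMe≈NMe = begin
          N * (e * M * e)  ≈⟨ *-assoc N (e * M) e ⟨
          N * (e * M) * e  ≈⟨ *-congʳ (*-assoc N e M) ⟨
          N * e * M * e    ≈⟨ *-congʳ (*-congʳ (corner-absorbʳ N∈eRe)) ⟩
          N * M * e        ∎

module TerwilligerCorners {c ℓ} (F : Field c ℓ) {n d : ℕ}
                          (S : AssociationScheme n d) (x : Fin n) where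
  open Field F hiding (zero)
  open AssociationScheme S using (rel)
  open Terwilliger F S x
  open MatrixRing F n
  open import Algebra.Properties.Ring ring using (-1*x≈-x)
  open import Relation.Binary.Reasoning.Setoid setoid

  InT-isSubring : IsSubring ⊗-ring InT
  InT-isSubring = record
    { ∈-resp-≈ = t-eq
    ; 1∈       = t-one
    ; +-closed = t-add
    ; *-closed = t-mul
    ; -‿closed = λ {M} M∈T → t-eq (λ i j → -1*x≈-x (M i j)) (t-scl (- 1#) M∈T)
    }

  open CornerRadical ⊗-ring InT-isSubring

  E*-isDiagonal : ∀ z → IsDiagonal (E* z)
  E*-isDiagonal z {i} {j} i≢j with i ≟ j | rel x i ≟ z
  ... | yes i≡j | _     = ⊥-elim (i≢j i≡j)
  ... | no _    | yes _ = refl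
  ... | no _    | no _  = refl

  E*-outside : ∀ {z i} j → ¬ rel x i ≡ z → E* z i j ≈ 0#
  E*-outside {z} {i} j xi∉z with i ≟ j | rel x i ≟ z
  ... | _     | yes xi∈z = ⊥-elim (xi∉z xi∈z)
  ... | yes _ | no _     = refl
  ... | no _  | no _     = refl

  E*-inside : ∀ {z i} → rel x i ≡ z → E* z i i ≈ 1#
  E*-inside {z} {i} xi∈z with i ≟ i | rel x i ≟ z
  ... | yes _   | yes _    = refl
  ... | no i≢i  | _        = ⊥-elim (i≢i ≡.refl)
  ... | yes _   | no xi∉z  = ⊥-elim (xi∉z xi∈z)

  E*-idempotent : ∀ z → E* z ⊗ E* z ≋ E* z
  E*-idempotent z i j = trans (diagonal-⊗ (E*-isDiagonal z) (E* z) i j) (E*ᵢᵢ*E*ᵢⱼ (rel x i ≟ z))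
    where
    E*ᵢᵢ*E*ᵢⱼ : Dec (rel x i ≡ z) → E* z i i * E* z i j ≈ E* z i j
    E*ᵢᵢ*E*ᵢⱼ (yes xi∈z) = trans (*-congʳ (E*-inside xi∈z)) (*-identityˡ _)
    E*ᵢᵢ*E*ᵢⱼ (no xi∉z)  =
      trans (*-congʳ (E*-outside i xi∉z)) (trans (zeroˡ _) (sym (E*-outside j xi∉z)))

  E*-sandwich : ∀ {a b i j} M → rel x i ≡ a → rel x j ≡ b → (E* a ⊗ M ⊗ E* b) i j ≈ M i j
  E*-sandwich {a} {b} {i} {j} M xi∈a xj∈b = begin
    (E* a ⊗ M ⊗ E* b) i j     ≈⟨ ⊗-diagonal (E*-isDiagonal b) (E* a ⊗ M) i j ⟩
    (E* a ⊗ M) i j * E* b j j ≈⟨ *-cong (diagonal-⊗ (E*-isDiagonal a) M i j) (E*-inside xj∈b) ⟩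
    E* a i i * M i j * 1#     ≈⟨ *-identityʳ _ ⟩
    E* a i i * M i j          ≈⟨ *-congʳ (E*-inside xi∈a) ⟩
    1# * M i j                ≈⟨ *-identityˡ _ ⟩
    M i j                     ∎

  semisimple⇒corners-semisimple : Semisimple InT I → ∀ z → Semisimple (InCorner z) (E* z)
  semisimple⇒corners-semisimple T-semisimple z N N-rad =
    T-semisimple N (radical-corner⇒radical (genE z) (E*-idempotent z) N-rad)

  corners-semisimple⇒semisimple :
    (∀ M → JacobsonRadical InT I M → ∀ a b → ¬ (a ≡ b) → E* a ⊗ M ⊗ E* b ≋ O) →
    (∀ z → Semisimple (InCorner z) (E* z)) → Semisimple InT I
  corners-semisimple⇒semisimple offDiagonal-vanish corners-semisimple M M-rad i j
    with rel x i ≟ rel x j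
  ... | no xi≢xj = trans (sym (E*-sandwich M ≡.refl ≡.refl))
                         (offDiagonal-vanish M M-rad _ _ xi≢xj i j)
  ... | yes xi≡xj = trans (sym (E*-sandwich M ≡.refl (≡.sym xi≡xj)))
                          (corners-semisimple a _ (radical⇒corner-radical (genE a) (E*-idempotent a) M-rad) i j)
    where a = rel x i

proposition5p11 : ∀ {c ℓ} (F : Field c ℓ) (m d : ℕ)
    (S : AssociationScheme (suc m) d) (x : Fin (suc m)) →
    let open Terwilliger F S x in
    (∀ M → JacobsonRadical InT I M →
       ∀ a b → ¬ (a ≡ b) → E* a ⊗ M ⊗ E* b ≋ O) →
    Semisimple InT I ⇔ (∀ z → Semisimple (InCorner z) (E* z))
proposition5p11 F m d S x offDiagonal-vanish =
  mk⇔ semisimple⇒corners-semisimple (corners-semisimple⇒semisimple offDiagonal-vanish)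
  where open TerwilligerCorners F S x
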